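{- If $G$ and $H$ are connected graphs of order at least $2$, then $$\mathrm{gp}_{\rm o}(G)\,\mathrm{gp}_{\rm o}(H)\le \mathrm{gp}_{\rm o}(G\boxtimes H)\le b(G)\,b(H).$$ Moreover, if $G$ and $H$ are block graphs, then the lower and upper bounds coincide.
   Context: All graphs are finite and simple. For $X\subseteq V(G)$, two vertices $u,v$ are $X$-positionable if no shortest $u,v$-path has an internal vertex in $X$. $X$ is an outer general position set if every two vertices of $X$ are $X$-positionable and every $u\in X$, $v\in V(G)\setminus X$ are $X$-positionable; $\mathrm{gp}_{\rm o}(G)$ is the maximum cardinality of such a set. A vertex $u$ is maximally distant from $v$ if every neighbour $w$ of $u$ satisfies $d_G(v,w)\le d_G(u,v)$; $u,v$ are mutually maximally distant (MMD) if each is maximally distant from the other. The boundary $\partial(G)$ is the set of vertices that are MMD with some other vertex, and $b(G)=|\partial(G)|$. A block graph is a connected graph in which every block (maximal 2-connected subgraph or bridge) is complete. The strong product $G\boxtimes H$ has vertex set $V(G)\times V(H)$, with $(g,h)$ and $(g',h')$ adjacent iff either $g=g'$ and $hh'\in E(H)$, or $gg'\in E(G)$ and $h=h'$, or $gg'\in E(G)$ and $hh'\in E(H)$. -}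

module Defs where

open import Data.Nat using (ℕ; zero; suc; _≤_; _*_)
open import Data.Bool using (Bool; true; false; _∧_; _∨_; T)
open import Data.Bool.Properties using (∧-comm; ∧-zeroʳ)
open import Data.Fin using (Fin; _≟_; remQuot)
open import Data.Fin.Subset using (Subset; _∈_; _∉_; _⊆_; ∣_∣)
open import Data.Product using (Σ; ∃; _×_; _,_; proj₁; proj₂)
open import Data.Sum using (_⊎_)
open import Data.Empty using (⊥)
open import Relation.Nullary using (¬_; yes; no)
open import Relation.Nullary.Decidable using (⌊_⌋)
open import Relation.Binary.PropositionalEquality using (_≡_; _≢_; refl; sym; cong₂)
open import Function.Bundles using (_⇔_)

record Graph : Set where
  field
    order   : ℕ
    adj     : Fin order → Fin order → Bool
    adj-sym : ∀ u v → adj u v ≡ adj v u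
    adj-irr : ∀ u → adj u u ≡ false

open Graph public

Vertex : Graph → Set
Vertex G = Fin (order G)

Adj : (G : Graph) → Vertex G → Vertex G → Set
Adj G u v = T (adj G u v)

data Walk (G : Graph) : Vertex G → Vertex G → ℕ → Set where
  nil  : ∀ {u} → Walk G u u 0
  cons : ∀ {u w v k} → Adj G u w → Walk G w v k → Walk G u v (suc k)

Inner : ∀ {G u v k} → Walk G u v k → Vertex G → Set
Inner nil x = ⊥
Inner (cons a nil) x = ⊥
Inner (cons {w = w} a p@(cons _ _)) x = (x ≡ w) ⊎ Inner p x

AllOn : ∀ {G u v k} → Walk G u v k → (Vertex G → Set) → Set
AllOn {u = u} nil P = P u
AllOn {u = u} (cons a p) P = P u × AllOn p P

Dist : (G : Graph) → Vertex G → Vertex G → ℕ → Set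
Dist G u v k = Walk G u v k × (∀ m → Walk G u v m → k ≤ m)

Connected : Graph → Set
Connected G = ∀ u v → ∃ λ k → Walk G u v k

Positionable : (G : Graph) → Subset (order G) → Vertex G → Vertex G → Set
Positionable G X u v =
  ∀ k (p : Walk G u v k) → Dist G u v k → ∀ x → Inner p x → x ∉ X

OuterGP : (G : Graph) → Subset (order G) → Set
OuterGP G X =
  (∀ u v → u ∈ X → v ∈ X → u ≢ v → Positionable G X u v) ×
  (∀ u v → u ∈ X → v ∉ X → Positionable G X u v)

IsGpo : Graph → ℕ → Set
IsGpo G k =
  (Σ (Subset (order G)) λ X → OuterGP G X × ∣ X ∣ ≡ k) ×
  (∀ X → OuterGP G X → ∣ X ∣ ≤ k)

MaxDistant : (G : Graph) → Vertex G → Vertex G → Set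
MaxDistant G u v =
  ∀ w k l → Adj G u w → Dist G v w k → Dist G u v l → k ≤ l

MMD : (G : Graph) → Vertex G → Vertex G → Set
MMD G u v = MaxDistant G u v × MaxDistant G v u

InBoundary : (G : Graph) → Vertex G → Set
InBoundary G v = ∃ λ u → u ≢ v × MMD G u v

BoundarySize : Graph → ℕ → Set
BoundarySize G k =
  Σ (Subset (order G)) λ S → (∀ v → (v ∈ S) ⇔ InBoundary G v) × ∣ S ∣ ≡ k

ConnectedOn : (G : Graph) → (Vertex G → Set) → Set
ConnectedOn G P =
  ∀ u v → P u → P v → ∃ λ k → Σ (Walk G u v k) λ p → AllOn p P

Nonseparable : (G : Graph) → Subset (order G) → Set
Nonseparable G B =
  ConnectedOn G (_∈ B) ×
  (∀ x → x ∈ B → ConnectedOn G (λ y → y ∈ B × y ≢ x))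

-- a block: a maximal nonempty connected subgraph without a cut vertex
-- (= maximal 2-connected subgraph, or bridge, or isolated vertex)
IsBlock : (G : Graph) → Subset (order G) → Set
IsBlock G B =
  (∃ λ x → x ∈ B) × Nonseparable G B ×
  (∀ B' → B ⊆ B' → Nonseparable G B' → B' ⊆ B)

IsComplete : (G : Graph) → Subset (order G) → Set
IsComplete G B = ∀ u v → u ∈ B → v ∈ B → u ≢ v → Adj G u v

IsBlockGraph : Graph → Set
IsBlockGraph G = Connected G × (∀ B → IsBlock G B → IsComplete G B)

-- Strong product, vertex (g,h) encoded in Fin (|G| * |H|) via remQuot

private
  eqᵇ : ∀ {n} → Fin n → Fin n → Bool
  eqᵇ i j = ⌊ i ≟ j ⌋

  eqᵇ-sym : ∀ {n} (i j : Fin n) → eqᵇ i j ≡ eqᵇ j i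
  eqᵇ-sym i j with i ≟ j | j ≟ i
  ... | yes _ | yes _ = refl
  ... | no _ | no _ = refl
  ... | yes p | no q = Data.Empty.⊥-elim (q (sym p))
    where import Data.Empty
  ... | no p | yes q = Data.Empty.⊥-elim (p (sym q))
    where import Data.Empty

  eqᵇ-refl : ∀ {n} (i : Fin n) → eqᵇ i i ≡ true
  eqᵇ-refl i with i ≟ i
  ... | yes _ = refl
  ... | no p = Data.Empty.⊥-elim (p refl)
    where import Data.Empty

  sadj : (G H : Graph) → Vertex G × Vertex H → Vertex G × Vertex H → Bool
  sadj G H (g , h) (g' , h') =
    (eqᵇ g g' ∧ adj H h h') ∨ (adj G g g' ∧ eqᵇ h h') ∨ (adj G g g' ∧ adj H h h')

  sadj-sym : (G H : Graph) → ∀ x y → sadj G H x y ≡ sadj G H y x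
  sadj-sym G H (g , h) (g' , h')
    rewrite eqᵇ-sym g g' | eqᵇ-sym h h' | adj-sym G g g' | adj-sym H h h' = refl

  sadj-irr : (G H : Graph) → ∀ x → sadj G H x x ≡ false
  sadj-irr G H (g , h)
    rewrite eqᵇ-refl g | eqᵇ-refl h | adj-irr G g | adj-irr H h = refl

_⊠_ : Graph → Graph → Graph
G ⊠ H = record
  { order   = order G * order H
  ; adj     = λ x y → sadj G H (dec x) (dec y)
  ; adj-sym = λ x y → sadj-sym G H (dec x) (dec y)
  ; adj-irr = λ x → sadj-irr G H (dec x)
  }
  where
    dec : Fin (order G * order H) → Vertex G × Vertex H
    dec = remQuot (order H)

-- A set is in outer general position exactly when its vertices are pairwise
-- mutually maximally distant.  Distances in G ⊠ H are maxima of the coordinate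
-- distances, so a product X × Y of two such sets is again one, which gives the
-- lower bound.  For two vertices of such a set in G ⊠ H, the coordinates in the
-- factor realising the larger distance are mutually maximally distant, hence on
-- the boundary; retracting every coordinate onto the boundary of its factor is
-- therefore injective on the set, which gives the upper bound.  In a block graph
-- no boundary vertex x is internal to a geodesic: its two neighbours on the
-- geodesic are distinct and nonadjacent, yet joined by geodesics to a vertex MMD
-- with x that avoid x, and x with such a walk would lie in a non-complete block.
-- So ∂(G) is itself in outer general position and the two bounds meet.

module Submission where

open import Defs
open import Data.Bool using (Bool; true; false; T; _∧_; _∨_; if_then_else_)
open import Data.Bool.Properties using (T-∧; T-∨)
open import Data.Empty using (⊥; ⊥-elim)
open import Data.Fin using (Fin; zero; suc; combine; remQuot; _≟_)
open import Data.Fin.Properties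
  using (any?; suc-injective; 0≢1+n; remQuot-combine; combine-remQuot; combine-injectiveˡ; combine-injectiveʳ)
open import Data.Fin.Subset using (Subset; _∈_; _∉_; _⊆_; _⊂_; _⊃_; ⁅_⁆; _∪_; ∣_∣; inside; outside; _-_)
  renaming (⊥ to ∅)
open import Data.Fin.Subset.Induction using (⊃-wellFounded)
open import Data.Fin.Subset.Properties
  using (_∈?_; x∈⁅x⁆; x∈⁅y⁆⇒x≡y; x∈p∪q⁺; x∈p∪q⁻; x∈p∧x≢y⇒x∈p-y; x∈p⇒∣p-x∣<∣p∣; ∣⊥∣≡0)
open import Data.List using (allFin; cartesianProduct)
open import Data.List.Extrema.Nat using (argmax; f[xs]≤f[argmax])
open import Data.List.Membership.Propositional.Properties using (∈-allFin; ∈-cartesianProduct⁺)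
import Data.List.Relation.Unary.All as All
open import Data.Nat using (ℕ; zero; suc; _≤_; _<_; _+_; _*_; _⊔_; z≤n; s≤s)
open import Data.Nat.Properties
  using (≤-antisym; ≤-trans; ≤-total; <-≤-trans; <⇒≱; ≮⇒≥; n<1+n; m<1+n⇒m<n∨m≡n; m≤n⇒m≤1+n; n≤0⇒n≡0;
         +-assoc; +-suc; +-cancelʳ-≤; +-monoˡ-≤; +-monoʳ-≤; +-mono-<; +-monoˡ-<; +-monoʳ-<; m≤n+m; m<m+n;
         ⊔-lub; m≤m⊔n; m≤n⊔m; m≥n⇒m⊔n≡m; m≤n⇒m⊔n≡n; *-mono-≤; module ≤-Reasoning)
open import Data.Product using (Σ; ∃; _×_; _,_; proj₁; proj₂; uncurry)
open import Data.Sum using (_⊎_; inj₁; inj₂; [_,_])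
open import Data.Unit using (⊤; tt)
open import Data.Vec using (_∷_; []; _++_; lookup; here; there)
open import Data.Vec.Properties using (lookup-++ˡ; lookup-++ʳ; lookup-replicate; []=⇒lookup; lookup⇒[]=)
open import Function using (_∘_; id)
open import Function.Bundles using (_⇔_; Equivalence)
open import Induction.WellFounded using (Acc; acc)
open import Relation.Nullary using (¬_; Dec; yes; no)
open import Relation.Nullary.Decidable using (⌊_⌋; _×-dec_; T?; ¬?; toWitness; fromWitness; ¬¬-excluded-middle)
open import Relation.Binary.PropositionalEquality hiding ([_])

least-witness : {P : ℕ → Set} → (∀ n → Dec (P n)) → ∀ {n} → P n →
                ∃ λ m → P m × (∀ j → P j → m ≤ j)
least-witness {P} P? {n} pn = [ id , (λ none → ⊥-elim (none n (n<1+n n) pn)) ] (search (suc n))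
  where
  search : ∀ k → (∃ λ m → P m × (∀ j → P j → m ≤ j)) ⊎ (∀ j → j < k → ¬ P j)
  search zero = inj₂ λ _ ()
  search (suc k) with search k
  ... | inj₁ least = inj₁ least
  ... | inj₂ none with P? k
  ...   | yes pk = inj₁ (k , pk , λ j pj → ≮⇒≥ λ j<k → none j j<k pj)
  ...   | no ¬pk = inj₂ λ j j<1+k pj →
          [ (λ j<k → none j j<k pj) , (λ { refl → ¬pk pj }) ] (m<1+n⇒m<n∨m≡n j<1+k)

two-distinct : ∀ {n} → 2 ≤ n → Σ (Fin n) λ a → Σ (Fin n) λ b → a ≢ b
two-distinct (s≤s (s≤s _)) = zero , suc zero , λ ()

maximum₂ : ∀ {n} (f : Fin n → Fin n → ℕ) → Fin n → ∃ λ u → ∃ λ v → ∀ x y → f x y ≤ f u v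
maximum₂ f a = proj₁ far , proj₂ far , λ x y →
  All.lookup (f[xs]≤f[argmax] {f = uncurry f} (a , a) _) (∈-cartesianProduct⁺ (∈-allFin x) (∈-allFin y))
  where
  far = argmax (uncurry f) (a , a) (cartesianProduct (allFin _) (allFin _))

module Walks (G : Graph) where

  private
    variable
      u v w x z : Vertex G
      i j k : ℕ
      Q R : Vertex G → Set

  Adj-sym : Adj G u v → Adj G v u
  Adj-sym {u} {v} = subst T (adj-sym G u v)

  Adj-irrefl : Adj G u v → u ≢ v
  Adj-irrefl {u} a refl = subst T (adj-irr G u) a

  infixr 5 _++ʷ_
  infixl 5 _∷ʳʷ_

  _++ʷ_ : Walk G u w i → Walk G w v j → Walk G u v (i + j)
  nil      ++ʷ q = q
  cons a p ++ʷ q = cons a (p ++ʷ q)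

  _∷ʳʷ_ : Walk G u w k → Adj G w v → Walk G u v (suc k)
  nil      ∷ʳʷ a = cons a nil
  cons b p ∷ʳʷ a = cons b (p ∷ʳʷ a)

  reverseʷ : Walk G u v k → Walk G v u k
  reverseʷ nil        = nil
  reverseʷ (cons a p) = reverseʷ p ∷ʳʷ Adj-sym a

  walk₀⇒≡ : Walk G u v 0 → u ≡ v
  walk₀⇒≡ nil = refl

  walk-length-pos : Walk G u v k → u ≢ v → 1 ≤ k
  walk-length-pos {k = zero}  p u≢v = ⊥-elim (u≢v (walk₀⇒≡ p))
  walk-length-pos {k = suc _} p u≢v = s≤s z≤n

  AllOn-head : (p : Walk G u v k) → AllOn p Q → Q u
  AllOn-head nil        q = q
  AllOn-head (cons _ _) q = proj₁ q

  AllOn-last : (p : Walk G u v k) → AllOn p Q → Q v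
  AllOn-last nil        q = q
  AllOn-last (cons _ p) q = AllOn-last p (proj₂ q)

  AllOn-map : (∀ {z} → Q z → R z) → (p : Walk G u v k) → AllOn p Q → AllOn p R
  AllOn-map f nil        q = f q
  AllOn-map f (cons _ p) q = f (proj₁ q) , AllOn-map f p (proj₂ q)

  AllOn-zip : (p : Walk G u v k) → AllOn p Q → AllOn p R → AllOn p (λ z → Q z × R z)
  AllOn-zip nil        q r = q , r
  AllOn-zip (cons _ p) q r = (proj₁ q , proj₁ r) , AllOn-zip p (proj₂ q) (proj₂ r)

  AllOn-++ : (p : Walk G u w i) (q : Walk G w v j) → AllOn p Q → AllOn q Q → AllOn (p ++ʷ q) Q
  AllOn-++ nil        q _  aq = aq
  AllOn-++ (cons _ p) q ap aq = proj₁ ap , AllOn-++ p q (proj₂ ap) aq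

  AllOn-∷ʳ : (p : Walk G u w k) (a : Adj G w v) → AllOn p Q → Q v → AllOn (p ∷ʳʷ a) Q
  AllOn-∷ʳ nil        a ap qv = ap , qv
  AllOn-∷ʳ (cons _ p) a ap qv = proj₁ ap , AllOn-∷ʳ p a (proj₂ ap) qv

  AllOn-reverse : (p : Walk G u v k) → AllOn p Q → AllOn (reverseʷ p) Q
  AllOn-reverse nil        ap = ap
  AllOn-reverse (cons a p) ap = AllOn-∷ʳ (reverseʷ p) _ (AllOn-reverse p (proj₂ ap)) (proj₁ ap)

  AllOn-⊤ : (p : Walk G u v k) → AllOn p (λ _ → ⊤)
  AllOn-⊤ nil        = tt
  AllOn-⊤ (cons _ p) = tt , AllOn-⊤ p

  walkOn? : (∀ z → Dec (Q z)) → ∀ k u v → Dec (Σ (Walk G u v k) λ p → AllOn p Q)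
  walkOn? Q? zero u v with u ≟ v
  ... | no u≢v = no λ { (nil , _) → u≢v refl }
  ... | yes refl with Q? u
  ...   | yes qu = yes (nil , qu)
  ...   | no ¬qu = no λ { (nil , qu) → ¬qu qu }
  walkOn? Q? (suc k) u v with Q? u | any? (λ w → T? (adj G u w) ×-dec walkOn? Q? k w v)
  ... | no ¬qu | _                     = no λ { (cons _ _ , qu , _) → ¬qu qu }
  ... | yes qu | yes (w , a , p , ap)  = yes (cons a p , qu , ap)
  ... | yes qu | no ¬step              = no λ { (cons a p , _ , ap) → ¬step (_ , a , p , ap) }

  verticesʷ : Walk G u v k → Subset (order G)
  verticesʷ {u} nil        = ⁅ u ⁆
  verticesʷ {u} (cons _ p) = ⁅ u ⁆ ∪ verticesʷ p

  AllOn-vertices : (p : Walk G u v k) → AllOn p (_∈ verticesʷ p)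
  AllOn-vertices {u} nil        = x∈⁅x⁆ u
  AllOn-vertices {u} (cons _ p) =
    x∈p∪q⁺ (inj₁ (x∈⁅x⁆ u)) , AllOn-map (λ z∈p → x∈p∪q⁺ (inj₂ z∈p)) p (AllOn-vertices p)

  ∉vertices⇒AllOn≢ : (p : Walk G u v k) → z ∉ verticesʷ p → AllOn p (_≢ z)
  ∉vertices⇒AllOn≢ {u} nil        z∉p refl = z∉p (x∈⁅x⁆ u)
  ∉vertices⇒AllOn≢ {u} (cons _ p) z∉p =
    (λ { refl → z∉p (x∈p∪q⁺ (inj₁ (x∈⁅x⁆ u))) }) ,
    ∉vertices⇒AllOn≢ p (λ z∈p → z∉p (x∈p∪q⁺ (inj₂ z∈p)))

  split-at-vertex : (p : Walk G u v k) → AllOn p Q → z ∈ verticesʷ p →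
    ∃ λ i → ∃ λ j → Σ (Walk G u z i) λ p₁ → Σ (Walk G z v j) λ p₂ →
      AllOn p₁ Q × AllOn p₂ Q × i + j ≡ k
  split-at-vertex {u = u} nil ap z∈p with x∈⁅y⁆⇒x≡y u z∈p
  ... | refl = 0 , 0 , nil , nil , ap , ap , refl
  split-at-vertex {u = u} (cons a p) ap z∈p with x∈p∪q⁻ ⁅ u ⁆ (verticesʷ p) z∈p
  ... | inj₁ z∈u with x∈⁅y⁆⇒x≡y u z∈u
  ...   | refl = 0 , _ , nil , cons a p , proj₁ ap , ap , refl
  split-at-vertex (cons a p) ap z∈p | inj₂ z∈p′ with split-at-vertex p (proj₂ ap) z∈p′
  ... | i , j , p₁ , p₂ , ap₁ , ap₂ , eq = suc i , j , cons a p₁ , p₂ , (proj₁ ap , ap₁) , ap₂ , cong suc eq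

  inner-split : (p : Walk G u v k) → Inner p x →
    ∃ λ i → ∃ λ j → ∃ λ w₁ → ∃ λ w₂ →
      Walk G u w₁ i × Adj G w₁ x × Adj G x w₂ × Walk G w₂ v j × k ≡ suc i + suc j
  inner-split (cons a (cons b p)) (inj₁ refl) = 0 , _ , _ , _ , nil , a , b , p , refl
  inner-split (cons a p@(cons _ _)) (inj₂ x∈p) with inner-split p x∈p
  ... | i , j , w₁ , w₂ , p₁ , a₁ , a₂ , p₂ , eq = suc i , j , w₁ , w₂ , cons a p₁ , a₁ , a₂ , p₂ , cong suc eq

  inner-∷ʳ : (p : Walk G u x (suc k)) (a : Adj G x v) → Inner (p ∷ʳʷ a) x
  inner-∷ʳ (cons b nil)            a = inj₁ refl
  inner-∷ʳ (cons b p@(cons _ _))   a = inj₂ (inner-∷ʳ p a)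

module Distance (G : Graph) where

  open Walks G

  private
    variable
      u v w : Vertex G
      i j k l : ℕ

  Dist-unique : Dist G u v k → Dist G u v l → k ≡ l
  Dist-unique (p , p-min) (q , q-min) = ≤-antisym (p-min _ q) (q-min _ p)

  Dist-sym : Dist G u v k → Dist G v u k
  Dist-sym (p , p-min) = reverseʷ p , λ m q → p-min m (reverseʷ q)

  Dist-refl : Dist G u u 0
  Dist-refl = nil , λ _ _ → z≤n

  Dist₀⇒≡ : Dist G u v 0 → u ≡ v
  Dist₀⇒≡ (p , _) = walk₀⇒≡ p

  Dist-self : Dist G u u k → k ≡ 0
  Dist-self d = Dist-unique d Dist-refl

  Dist-pos : Dist G u v k → u ≢ v → 1 ≤ k
  Dist-pos (p , _) = walk-length-pos p

  Dist-adj : Dist G u v k → Adj G u v → k ≤ 1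
  Dist-adj (_ , p-min) a = p-min 1 (cons a nil)

  Dist-prefix : (p : Walk G u w i) → Walk G w v j → Dist G u v (i + j) → Dist G u w i
  Dist-prefix {j = j} p q (_ , min) =
    p , λ m r → +-cancelʳ-≤ j _ m (min _ (r ++ʷ q))

  shortest-walk : Walk G u v k → ∃ (Dist G u v)
  shortest-walk {u} {v} p with least-witness (λ k → walkOn? (λ _ → yes tt) k u v) (p , AllOn-⊤ p)
  ... | m , (q , _) , q-min = m , q , λ n r → q-min n (r , AllOn-⊤ r)

  distance : Connected G → ∀ u v → ∃ (Dist G u v)
  distance conn u v = shortest-walk (proj₂ (conn u v))

  boundary-nonempty : Connected G → 2 ≤ order G → ∃ (InBoundary G)
  boundary-nonempty conn = diametral (λ x y → proj₁ (distance conn x y)) (λ x y → proj₂ (distance conn x y))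
    where
    diametral : (d : Vertex G → Vertex G → ℕ) → (∀ x y → Dist G x y (d x y)) → 2 ≤ order G → ∃ (InBoundary G)
    diametral d Dist-d 2≤n with two-distinct 2≤n | maximum₂ d (proj₁ (two-distinct 2≤n))
    ... | a , b , a≢b | u , v , d≤duv = v , u , u≢v , far , far′
      where
      ≤diameter : ∀ {x y k} → Dist G x y k → k ≤ d u v
      ≤diameter {x} {y} D = subst (_≤ d u v) (Dist-unique (Dist-d x y) D) (d≤duv x y)

      u≢v : u ≢ v
      u≢v refl = <⇒≱ (Dist-pos (Dist-d a b) a≢b) (subst (d a b ≤_) (Dist-self (Dist-d u u)) (d≤duv a b))

      far : MaxDistant G u v
      far w k l _ D D′ = subst (k ≤_) (Dist-unique (Dist-d u v) D′) (≤diameter D)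

      far′ : MaxDistant G v u
      far′ w k l _ D D′ = subst (k ≤_) (Dist-unique (Dist-sym (Dist-d u v)) D′) (≤diameter D)

module OuterPosition (G : Graph) where

  open Walks G
  open Distance G

  private
    variable
      u v w x : Vertex G
      k l : ℕ
      X : Subset (order G)

  PairwiseMaxDistant : Subset (order G) → Set
  PairwiseMaxDistant X = ∀ {u x} → u ∈ X → x ∈ X → u ≢ x → MaxDistant G x u

  outerGP⇒pairwiseMaxDistant : OuterGP G X → PairwiseMaxDistant X
  outerGP⇒pairwiseMaxDistant {X} (in-in , in-out) {u} {x} u∈X x∈X u≢x w k l x~w Duw Dxu =
    ≮⇒≥ (detour Dxu)
    where
    -- a geodesic from u to x followed by the edge x w would be a geodesic through x
    detour : ∀ {l} → Dist G x u l → l < k → ⊥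
    detour {zero}  D _ = u≢x (sym (Dist₀⇒≡ D))
    detour {suc l} (p , _) l<k = positionable _ q Dq x (inner-∷ʳ (reverseʷ p) x~w) x∈X
      where
      q : Walk G u w (suc (suc l))
      q = reverseʷ p ∷ʳʷ x~w

      Dq : Dist G u w (suc (suc l))
      Dq = q , λ m r → subst (_≤ m) (≤-antisym (proj₂ Duw _ q) l<k) (proj₂ Duw m r)

      u≢w : u ≢ w
      u≢w refl with Dist-self Dq
      ... | ()

      positionable : Positionable G X u w
      positionable with w ∈? X
      ... | yes w∈X = in-in u w u∈X w∈X u≢w
      ... | no  w∉X = in-out u w u∈X w∉X

  pairwiseMaxDistant⇒positionable : PairwiseMaxDistant X → u ∈ X → Positionable G X u v
  pairwiseMaxDistant⇒positionable {u = u} {v} md u∈X k p D x x∈p x∈X with inner-split p x∈p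
  ... | i , j , w₁ , w₂ , p₁ , a₁ , a₂ , p₂ , refl =
    <⇒≱ (n<1+n (suc i)) (md u∈X x∈X u≢x w₂ (suc (suc i)) (suc i) a₂ Duw₂ (Dist-sym Dux))
    where
    Dux : Dist G u x (suc i)
    Dux = Dist-prefix (p₁ ∷ʳʷ a₁) (cons a₂ p₂) D

    Duw₂ : Dist G u w₂ (suc (suc i))
    Duw₂ = Dist-prefix (p₁ ∷ʳʷ a₁ ∷ʳʷ a₂) p₂ (subst (Dist G u v) (+-suc (suc i) j) D)

    u≢x : u ≢ x
    u≢x refl with Dist-self Dux
    ... | ()

  pairwiseMaxDistant⇒outerGP : PairwiseMaxDistant X → OuterGP G X
  pairwiseMaxDistant⇒outerGP md =
    (λ _ _ u∈X _ _ → pairwiseMaxDistant⇒positionable md u∈X) ,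
    (λ _ _ u∈X _ → pairwiseMaxDistant⇒positionable md u∈X)

  dist-closedNeighbour≤ : PairwiseMaxDistant X → u ∈ X → x ∈ X → x ≡ w ⊎ Adj G x w →
                          Dist G u x k → Dist G u w l → l ≤ k ⊔ 1
  dist-closedNeighbour≤ md u∈X x∈X (inj₁ refl) D D′ = subst (_≤ _ ⊔ 1) (Dist-unique D D′) (m≤m⊔n _ 1)
  dist-closedNeighbour≤ {u = u} {x = x} md u∈X x∈X (inj₂ x~w) D D′ with u ≟ x
  ... | yes refl = ≤-trans (Dist-adj D′ x~w) (m≤n⊔m _ 1)
  ... | no  u≢x  = ≤-trans (md u∈X x∈X u≢x _ _ _ x~w D′ (Dist-sym D)) (m≤m⊔n _ 1)

private
  variable
    m n : ℕ

∣p++q∣≡∣p∣+∣q∣ : (p : Subset m) (q : Subset n) → ∣ p ++ q ∣ ≡ ∣ p ∣ + ∣ q ∣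
∣p++q∣≡∣p∣+∣q∣ []            q = refl
∣p++q∣≡∣p∣+∣q∣ (inside  ∷ p) q = cong suc (∣p++q∣≡∣p∣+∣q∣ p q)
∣p++q∣≡∣p∣+∣q∣ (outside ∷ p) q = ∣p++q∣≡∣p∣+∣q∣ p q

infixr 7 _×ˢ_

_×ˢ_ : Subset m → Subset n → Subset (m * n)
[]      ×ˢ q = []
(b ∷ p) ×ˢ q = (if b then q else ∅) ++ (p ×ˢ q)

∣p×ˢq∣≡∣p∣*∣q∣ : (p : Subset m) (q : Subset n) → ∣ p ×ˢ q ∣ ≡ ∣ p ∣ * ∣ q ∣
∣p×ˢq∣≡∣p∣*∣q∣ []            q = refl
∣p×ˢq∣≡∣p∣*∣q∣ (inside  ∷ p) q = trans (∣p++q∣≡∣p∣+∣q∣ q (p ×ˢ q)) (cong (∣ q ∣ +_) (∣p×ˢq∣≡∣p∣*∣q∣ p q))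
∣p×ˢq∣≡∣p∣*∣q∣ {n = n} (outside ∷ p) q =
  trans (∣p++q∣≡∣p∣+∣q∣ (∅ {n}) (p ×ˢ q)) (cong₂ _+_ (∣⊥∣≡0 n) (∣p×ˢq∣≡∣p∣*∣q∣ p q))

lookup-×ˢ : (p : Subset m) (q : Subset n) (i : Fin m) (j : Fin n) →
            lookup (p ×ˢ q) (combine i j) ≡ lookup p i ∧ lookup q j
lookup-×ˢ (true  ∷ p) q zero    j = lookup-++ˡ q (p ×ˢ q) j
lookup-×ˢ {n = n} (false ∷ p) q zero    j = trans (lookup-++ˡ (∅ {n}) (p ×ˢ q) j) (lookup-replicate j false)
lookup-×ˢ (true  ∷ p) q (suc i) j = trans (lookup-++ʳ q (p ×ˢ q) (combine i j)) (lookup-×ˢ p q i j)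
lookup-×ˢ {n = n} (false ∷ p) q (suc i) j = trans (lookup-++ʳ (∅ {n}) (p ×ˢ q) (combine i j)) (lookup-×ˢ p q i j)

combine∈×ˢ⁻ : (p : Subset m) (q : Subset n) {i : Fin m} {j : Fin n} → combine i j ∈ p ×ˢ q → i ∈ p × j ∈ q
combine∈×ˢ⁻ p q {i} {j} ij∈
  with lookup p i in i∈p | lookup q j in j∈q | trans (sym (lookup-×ˢ p q i j)) ([]=⇒lookup ij∈)
... | true  | true  | _  = lookup⇒[]= i p i∈p , lookup⇒[]= j q j∈q
... | true  | false | ()
... | false | _     | ()

combine∈×ˢ⁺ : (p : Subset m) (q : Subset n) {i : Fin m} {j : Fin n} → i ∈ p → j ∈ q → combine i j ∈ p ×ˢ q
combine∈×ˢ⁺ p q {i} {j} i∈p j∈q =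
  lookup⇒[]= _ (p ×ˢ q) (trans (lookup-×ˢ p q i j) (cong₂ _∧_ ([]=⇒lookup i∈p) ([]=⇒lookup j∈q)))

∣p∣≤∣q∣-injection : (p : Subset m) (q : Subset n) (f : Fin m → Fin n) →
                    (∀ {i} → i ∈ p → f i ∈ q) →
                    (∀ {i j} → i ∈ p → j ∈ p → f i ≡ f j → i ≡ j) → ∣ p ∣ ≤ ∣ q ∣
∣p∣≤∣q∣-injection []            q f _    _   = z≤n
∣p∣≤∣q∣-injection (outside ∷ p) q f into inj =
  ∣p∣≤∣q∣-injection p q (f ∘ suc) (into ∘ there) (λ i∈p j∈p e → suc-injective (inj (there i∈p) (there j∈p) e))
∣p∣≤∣q∣-injection (inside ∷ p) q f into inj =
  ≤-trans (s≤s (∣p∣≤∣q∣-injection p (q - f zero) (f ∘ suc) into′ inj′)) (x∈p⇒∣p-x∣<∣p∣ (into here))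
  where
  into′ : ∀ {i} → i ∈ p → f (suc i) ∈ q - f zero
  into′ i∈p = x∈p∧x≢y⇒x∈p-y (into (there i∈p)) (λ e → 0≢1+n (inj here (there i∈p) (sym e)))
  inj′ : ∀ {i j} → i ∈ p → j ∈ p → f (suc i) ≡ f (suc j) → i ≡ j
  inj′ i∈p j∈p e = suc-injective (inj (there i∈p) (there j∈p) e)

retractTo : Subset n → Fin n → Fin n → Fin n
retractTo p d i with i ∈? p
... | yes _ = i
... | no  _ = d

retractTo-∈ : ∀ {p : Subset n} {d} i → d ∈ p → retractTo p d i ∈ p
retractTo-∈ {p = p} i d∈p with i ∈? p
... | yes i∈p = i∈p
... | no  _   = d∈p

retractTo-id : ∀ {p : Subset n} {d i} → i ∈ p → retractTo p d i ≡ i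
retractTo-id {p = p} {i = i} i∈p with i ∈? p
... | yes _   = refl
... | no  i∉p = ⊥-elim (i∉p i∈p)

retractTo-injective : ∀ {p : Subset n} {d i j} → i ∈ p → j ∈ p → retractTo p d i ≡ retractTo p d j → i ≡ j
retractTo-injective i∈p j∈p e = trans (sym (retractTo-id i∈p)) (trans e (retractTo-id j∈p))

-- The adjacency test of _⊠_ in Defs, with its two equality tests as decisions.
strong-disjunction⁻ : ∀ {A B : Set} (a? : Dec A) (b? : Dec B) (g h : Bool) →
  T ((⌊ a? ⌋ ∧ h) ∨ (g ∧ ⌊ b? ⌋) ∨ (g ∧ h)) → (A ⊎ T g) × (B ⊎ T h)
strong-disjunction⁻ a? b? g h t with Equivalence.to (T-∨ {⌊ a? ⌋ ∧ h}) t
... | inj₁ t₁ = let (ta , th) = Equivalence.to (T-∧ {⌊ a? ⌋}) t₁ in inj₁ (toWitness ta) , inj₂ th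
... | inj₂ t₂ with Equivalence.to (T-∨ {g ∧ ⌊ b? ⌋}) t₂
...   | inj₁ t₃ = let (tg , tb) = Equivalence.to (T-∧ {g}) t₃ in inj₂ tg , inj₁ (toWitness tb)
...   | inj₂ t₄ = let (tg , th) = Equivalence.to (T-∧ {g}) t₄ in inj₂ tg , inj₂ th

strong-disjunction⁺ : ∀ {A B : Set} (a? : Dec A) (b? : Dec B) (g h : Bool) →
  A ⊎ T g → B ⊎ T h → ¬ (A × B) → T ((⌊ a? ⌋ ∧ h) ∨ (g ∧ ⌊ b? ⌋) ∨ (g ∧ h))
strong-disjunction⁺ a? b? g h (inj₁ a)  (inj₁ b)  ¬ab = ⊥-elim (¬ab (a , b))
strong-disjunction⁺ a? b? g h (inj₁ a)  (inj₂ th) _   =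
  Equivalence.from (T-∨ {⌊ a? ⌋ ∧ h}) (inj₁
    (Equivalence.from (T-∧ {⌊ a? ⌋}) (fromWitness {a? = a?} a , th)))
strong-disjunction⁺ a? b? g h (inj₂ tg) (inj₁ b)  _   =
  Equivalence.from (T-∨ {⌊ a? ⌋ ∧ h}) (inj₂
    (Equivalence.from (T-∨ {g ∧ ⌊ b? ⌋}) (inj₁
      (Equivalence.from (T-∧ {g}) (tg , fromWitness {a? = b?} b)))))
strong-disjunction⁺ a? b? g h (inj₂ tg) (inj₂ th) _   =
  Equivalence.from (T-∨ {⌊ a? ⌋ ∧ h}) (inj₂
    (Equivalence.from (T-∨ {g ∧ ⌊ b? ⌋}) (inj₂
      (Equivalence.from (T-∧ {g}) (tg , th)))))

module StrongProduct (G H : Graph) where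

  private
    module WG = Walks G
    module WH = Walks H
    module DG = Distance G
    module DH = Distance H
    module W⊠ = Walks (G ⊠ H)

    variable
      x y : Vertex (G ⊠ H)
      g g′ : Vertex G
      h h′ : Vertex H
      a b k : ℕ

  π : Vertex (G ⊠ H) → Vertex G × Vertex H
  π = remQuot (order H)

  πᴳ : Vertex (G ⊠ H) → Vertex G
  πᴳ x = proj₁ (π x)

  πᴴ : Vertex (G ⊠ H) → Vertex H
  πᴴ x = proj₂ (π x)

  π-combine : (g : Vertex G) (h : Vertex H) → π (combine g h) ≡ (g , h)
  π-combine = remQuot-combine

  π-injective : π x ≡ π y → x ≡ y
  π-injective {x} {y} e = begin
    x                       ≡⟨ combine-remQuot {order G} (order H) x ⟨
    uncurry combine (π x)   ≡⟨ cong (uncurry combine) e ⟩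
    uncurry combine (π y)   ≡⟨ combine-remQuot {order G} (order H) y ⟩
    y                       ∎
    where open ≡-Reasoning

  StrongAdj : Vertex G × Vertex H → Vertex G × Vertex H → Set
  StrongAdj (g , h) (g′ , h′) = (g ≡ g′ ⊎ Adj G g g′) × (h ≡ h′ ⊎ Adj H h h′) × (g , h) ≢ (g′ , h′)

  adj-⊠⁻ : Adj (G ⊠ H) x y → StrongAdj (π x) (π y)
  adj-⊠⁻ {x} {y} x~y
    with strong-disjunction⁻ (πᴳ x ≟ πᴳ y) (πᴴ x ≟ πᴴ y) (adj G (πᴳ x) (πᴳ y)) (adj H (πᴴ x) (πᴴ y)) x~y
  ... | g-step , h-step = g-step , h-step , λ e → W⊠.Adj-irrefl x~y (π-injective e)

  adj-⊠⁺ : StrongAdj (π x) (π y) → Adj (G ⊠ H) x y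
  adj-⊠⁺ {x} {y} (g-step , h-step , πx≢πy) =
    strong-disjunction⁺ (πᴳ x ≟ πᴳ y) (πᴴ x ≟ πᴴ y) (adj G (πᴳ x) (πᴳ y)) (adj H (πᴴ x) (πᴴ y))
      g-step h-step (λ (e₁ , e₂) → πx≢πy (cong₂ _,_ e₁ e₂))

  adj-combine : StrongAdj (g , h) (g′ , h′) → Adj (G ⊠ H) (combine g h) (combine g′ h′)
  adj-combine {g} {h} {g′} {h′} s =
    adj-⊠⁺ (subst₂ StrongAdj (sym (π-combine g h)) (sym (π-combine g′ h′)) s)

  adj-⊠ˡ : Adj G (πᴳ x) g → Adj (G ⊠ H) x (combine g (πᴴ x))
  adj-⊠ˡ {x} {g} a =
    adj-⊠⁺ (subst (StrongAdj (π x)) (sym (π-combine g (πᴴ x)))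
                  (inj₂ a , inj₁ refl , λ e → WG.Adj-irrefl a (cong proj₁ e)))

  adj-⊠ʳ : Adj H (πᴴ x) h → Adj (G ⊠ H) x (combine (πᴳ x) h)
  adj-⊠ʳ {x} {h} a =
    adj-⊠⁺ (subst (StrongAdj (π x)) (sym (π-combine (πᴳ x) h))
                  (inj₁ refl , inj₂ a , λ e → WH.Adj-irrefl a (cong proj₂ e)))

  walk-πᴳ : Walk (G ⊠ H) x y k → ∃ λ k′ → k′ ≤ k × Walk G (πᴳ x) (πᴳ y) k′
  walk-πᴳ nil = 0 , z≤n , nil
  walk-πᴳ (cons x~z p) with walk-πᴳ p | proj₁ (adj-⊠⁻ x~z)
  ... | k′ , k′≤k , q | inj₁ e   = k′ , m≤n⇒m≤1+n k′≤k , subst (λ g → Walk G g _ k′) (sym e) q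
  ... | k′ , k′≤k , q | inj₂ g~g = suc k′ , s≤s k′≤k , cons g~g q

  walk-πᴴ : Walk (G ⊠ H) x y k → ∃ λ k′ → k′ ≤ k × Walk H (πᴴ x) (πᴴ y) k′
  walk-πᴴ nil = 0 , z≤n , nil
  walk-πᴴ (cons x~z p) with walk-πᴴ p | proj₁ (proj₂ (adj-⊠⁻ x~z))
  ... | k′ , k′≤k , q | inj₁ e   = k′ , m≤n⇒m≤1+n k′≤k , subst (λ h → Walk H h _ k′) (sym e) q
  ... | k′ , k′≤k , q | inj₂ h~h = suc k′ , s≤s k′≤k , cons h~h q

  walk-⊠ˡ : Walk G g g′ a → Walk (G ⊠ H) (combine g h) (combine g′ h) a
  walk-⊠ˡ nil          = nil
  walk-⊠ˡ (cons g~ p) =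
    cons (adj-combine (inj₂ g~ , inj₁ refl , λ e → WG.Adj-irrefl g~ (cong proj₁ e))) (walk-⊠ˡ p)

  walk-⊠ʳ : Walk H h h′ b → Walk (G ⊠ H) (combine g h) (combine g h′) b
  walk-⊠ʳ nil          = nil
  walk-⊠ʳ (cons h~ q) =
    cons (adj-combine (inj₁ refl , inj₂ h~ , λ e → WH.Adj-irrefl h~ (cong proj₂ e))) (walk-⊠ʳ q)

  walk-⊠ : Walk G g g′ a → Walk H h h′ b → Walk (G ⊠ H) (combine g h) (combine g′ h′) (a ⊔ b)
  walk-⊠ nil          q           = walk-⊠ʳ q
  walk-⊠ (cons g~ p) nil         = walk-⊠ˡ (cons g~ p)
  walk-⊠ (cons g~ p) (cons h~ q) =
    cons (adj-combine (inj₂ g~ , inj₂ h~ , λ e → WG.Adj-irrefl g~ (cong proj₁ e))) (walk-⊠ p q)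

  Dist-⊠ : Dist G (πᴳ x) (πᴳ y) a → Dist H (πᴴ x) (πᴴ y) b → Dist (G ⊠ H) x y (a ⊔ b)
  Dist-⊠ {x} {y} (p , p-min) (q , q-min) =
    subst₂ (λ s t → Walk (G ⊠ H) s t _)
      (combine-remQuot {order G} (order H) x) (combine-remQuot {order G} (order H) y) (walk-⊠ p q) ,
    λ m r → ⊔-lub (shorter p-min (walk-πᴳ r)) (shorter q-min (walk-πᴴ r))
    where
    shorter : ∀ {W : ℕ → Set} {c m} → (∀ n → W n → c ≤ n) → ∃ (λ n → n ≤ m × W n) → c ≤ m
    shorter min (n , n≤m , w) = ≤-trans (min n w) n≤m

  Dist-⊠-combine : Dist G (πᴳ x) g a → Dist H (πᴴ x) h b → Dist (G ⊠ H) x (combine g h) (a ⊔ b)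
  Dist-⊠-combine {g = g} {h = h} Da Db =
    Dist-⊠ (subst (λ g → Dist G _ g _) (sym (cong proj₁ (π-combine g h))) Da)
           (subst (λ h → Dist H _ h _) (sym (cong proj₂ (π-combine g h))) Db)

  ≡-if-dominantᴳ : Dist G (πᴳ x) (πᴳ y) a → Dist H (πᴴ x) (πᴴ y) b → b ≤ a → πᴳ x ≡ πᴳ y → x ≡ y
  ≡-if-dominantᴳ {x} {y} {a} {b} Da Db b≤a e =
    π-injective (cong₂ _,_ e (DH.Dist₀⇒≡ (subst (Dist H _ _) b≡0 Db)))
    where
    b≡0 : b ≡ 0
    b≡0 = n≤0⇒n≡0 (subst (b ≤_) (DG.Dist-self (subst (λ g → Dist G g (πᴳ y) a) e Da)) b≤a)

  ≡-if-dominantᴴ : Dist G (πᴳ x) (πᴳ y) a → Dist H (πᴴ x) (πᴴ y) b → a ≤ b → πᴴ x ≡ πᴴ y → x ≡ y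
  ≡-if-dominantᴴ {x} {y} {a} {b} Da Db a≤b e =
    π-injective (cong₂ _,_ (DG.Dist₀⇒≡ (subst (Dist G _ _) a≡0 Da)) e)
    where
    a≡0 : a ≡ 0
    a≡0 = n≤0⇒n≡0 (subst (a ≤_) (DH.Dist-self (subst (λ h → Dist H h (πᴴ y) b) e Db)) a≤b)

  ∈×ˢ⁻ : ∀ {X : Subset (order G)} {Y : Subset (order H)} → x ∈ X ×ˢ Y → πᴳ x ∈ X × πᴴ x ∈ Y
  ∈×ˢ⁻ {x} {X} {Y} x∈ =
    combine∈×ˢ⁻ X Y (subst (_∈ X ×ˢ Y) (sym (combine-remQuot {order G} (order H) x)) x∈)

module ProductBounds (G H : Graph) (connG : Connected G) (connH : Connected H) where

  open StrongProduct G H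

  private
    module DG = Distance G
    module DH = Distance H
    module D⊠ = Distance (G ⊠ H)
    module OG = OuterPosition G
    module OH = OuterPosition H
    module O⊠ = OuterPosition (G ⊠ H)

    variable
      X : Subset (order G)
      Y : Subset (order H)
      Z : Subset (order (G ⊠ H))
      z₁ z₂ : Vertex (G ⊠ H)
      a b : ℕ

  ×ˢ-pairwiseMaxDistant : OG.PairwiseMaxDistant X → OH.PairwiseMaxDistant Y → O⊠.PairwiseMaxDistant (X ×ˢ Y)
  ×ˢ-pairwiseMaxDistant {X} {Y} mdX mdY {u} {x} u∈ x∈ u≢x w k l x~w Duw Dxu
    with DG.distance connG (πᴳ u) (πᴳ x) | DH.distance connH (πᴴ u) (πᴴ x)
       | DG.distance connG (πᴳ u) (πᴳ w) | DH.distance connH (πᴴ u) (πᴴ w)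
  ... | a , Da | b , Db | a′ , Da′ | b′ , Db′ =
    subst₂ _≤_ (D⊠.Dist-unique (Dist-⊠ Da′ Db′) Duw) (D⊠.Dist-unique (Dist-⊠ Da Db) (D⊠.Dist-sym Dxu))
      (⊔-lub (≤-trans a′≤a⊔1 (⊔-lub (m≤m⊔n a b) 1≤a⊔b)) (≤-trans b′≤b⊔1 (⊔-lub (m≤n⊔m a b) 1≤a⊔b)))
    where
    1≤a⊔b : 1 ≤ a ⊔ b
    1≤a⊔b = D⊠.Dist-pos (Dist-⊠ Da Db) u≢x

    a′≤a⊔1 : a′ ≤ a ⊔ 1
    a′≤a⊔1 = OG.dist-closedNeighbour≤ mdX (proj₁ (∈×ˢ⁻ {X = X} {Y} u∈)) (proj₁ (∈×ˢ⁻ {X = X} {Y} x∈))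
               (proj₁ (adj-⊠⁻ x~w)) Da Da′

    b′≤b⊔1 : b′ ≤ b ⊔ 1
    b′≤b⊔1 = OH.dist-closedNeighbour≤ mdY (proj₂ (∈×ˢ⁻ {X = X} {Y} u∈)) (proj₂ (∈×ˢ⁻ {X = X} {Y} x∈))
               (proj₁ (proj₂ (adj-⊠⁻ x~w))) Db Db′

  ×ˢ-outerGP : OuterGP G X → OuterGP H Y → OuterGP (G ⊠ H) (X ×ˢ Y)
  ×ˢ-outerGP oX oY = O⊠.pairwiseMaxDistant⇒outerGP
    (×ˢ-pairwiseMaxDistant (OG.outerGP⇒pairwiseMaxDistant oX) (OH.outerGP⇒pairwiseMaxDistant oY))

  maxDistantᴳ : O⊠.PairwiseMaxDistant Z → z₁ ∈ Z → z₂ ∈ Z → z₁ ≢ z₂ →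
                Dist G (πᴳ z₁) (πᴳ z₂) a → Dist H (πᴴ z₁) (πᴴ z₂) b → b ≤ a → MaxDistant G (πᴳ z₁) (πᴳ z₂)
  maxDistantᴳ {b = b} md z₁∈ z₂∈ z₁≢z₂ Da Db b≤a g k l g~ Dk Dl =
    ≤-trans (m≤m⊔n k b) (subst (k ⊔ b ≤_) (trans (m≥n⇒m⊔n≡m b≤a) (DG.Dist-unique Da Dl)) k⊔b≤a⊔b)
    where
    k⊔b≤a⊔b : k ⊔ b ≤ _ ⊔ b
    k⊔b≤a⊔b = md z₂∈ z₁∈ (z₁≢z₂ ∘ sym) _ _ _ (adj-⊠ˡ g~) (Dist-⊠-combine Dk (DH.Dist-sym Db)) (Dist-⊠ Da Db)

  maxDistantᴴ : O⊠.PairwiseMaxDistant Z → z₁ ∈ Z → z₂ ∈ Z → z₁ ≢ z₂ →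
                Dist G (πᴳ z₁) (πᴳ z₂) a → Dist H (πᴴ z₁) (πᴴ z₂) b → a ≤ b → MaxDistant H (πᴴ z₁) (πᴴ z₂)
  maxDistantᴴ {a = a} md z₁∈ z₂∈ z₁≢z₂ Da Db a≤b h k l h~ Dk Dl =
    ≤-trans (m≤n⊔m a k) (subst (a ⊔ k ≤_) (trans (m≤n⇒m⊔n≡n a≤b) (DH.Dist-unique Db Dl)) a⊔k≤a⊔b)
    where
    a⊔k≤a⊔b : a ⊔ k ≤ a ⊔ _
    a⊔k≤a⊔b = md z₂∈ z₁∈ (z₁≢z₂ ∘ sym) _ _ _ (adj-⊠ʳ h~) (Dist-⊠-combine (DG.Dist-sym Da) Dk) (Dist-⊠ Da Db)

  boundaryᴳ : O⊠.PairwiseMaxDistant Z → z₁ ∈ Z → z₂ ∈ Z → z₁ ≢ z₂ →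
              Dist G (πᴳ z₁) (πᴳ z₂) a → Dist H (πᴴ z₁) (πᴴ z₂) b → b ≤ a → InBoundary G (πᴳ z₁)
  boundaryᴳ md z₁∈ z₂∈ z₁≢z₂ Da Db b≤a =
    πᴳ _ , (λ e → z₁≢z₂ (≡-if-dominantᴳ Da Db b≤a (sym e))) ,
    maxDistantᴳ md z₂∈ z₁∈ (z₁≢z₂ ∘ sym) (DG.Dist-sym Da) (DH.Dist-sym Db) b≤a ,
    maxDistantᴳ md z₁∈ z₂∈ z₁≢z₂ Da Db b≤a

  boundaryᴴ : O⊠.PairwiseMaxDistant Z → z₁ ∈ Z → z₂ ∈ Z → z₁ ≢ z₂ →
              Dist G (πᴳ z₁) (πᴳ z₂) a → Dist H (πᴴ z₁) (πᴴ z₂) b → a ≤ b → InBoundary H (πᴴ z₁)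
  boundaryᴴ md z₁∈ z₂∈ z₁≢z₂ Da Db a≤b =
    πᴴ _ , (λ e → z₁≢z₂ (≡-if-dominantᴴ Da Db a≤b (sym e))) ,
    maxDistantᴴ md z₂∈ z₁∈ (z₁≢z₂ ∘ sym) (DG.Dist-sym Da) (DH.Dist-sym Db) a≤b ,
    maxDistantᴴ md z₁∈ z₂∈ z₁≢z₂ Da Db a≤b

  outerGP-⊠-≤ : OuterGP (G ⊠ H) Z →
                (∂G : Subset (order G)) → (∀ v → v ∈ ∂G ⇔ InBoundary G v) → ∀ {g₀} → g₀ ∈ ∂G →
                (∂H : Subset (order H)) → (∀ v → v ∈ ∂H ⇔ InBoundary H v) → ∀ {h₀} → h₀ ∈ ∂H →
                ∣ Z ∣ ≤ ∣ ∂G ∣ * ∣ ∂H ∣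
  outerGP-⊠-≤ {Z} oZ ∂G ∂G⇔ {g₀} g₀∈∂G ∂H ∂H⇔ {h₀} h₀∈∂H =
    subst (∣ Z ∣ ≤_) (∣p×ˢq∣≡∣p∣*∣q∣ ∂G ∂H) (∣p∣≤∣q∣-injection Z (∂G ×ˢ ∂H) f f-into f-injective)
    where
    md : O⊠.PairwiseMaxDistant Z
    md = O⊠.outerGP⇒pairwiseMaxDistant oZ

    -- For distinct i, j ∈ Z the factor with the larger distance has both coordinates
    -- on its boundary, where f is the identity.
    f : Vertex (G ⊠ H) → Vertex (G ⊠ H)
    f z = combine (retractTo ∂G g₀ (πᴳ z)) (retractTo ∂H h₀ (πᴴ z))

    f-into : ∀ {z} → z ∈ Z → f z ∈ ∂G ×ˢ ∂H
    f-into {z} _ = combine∈×ˢ⁺ ∂G ∂H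
      (retractTo-∈ (πᴳ z) g₀∈∂G) (retractTo-∈ (πᴴ z) h₀∈∂H)

    f-injective : ∀ {i j} → i ∈ Z → j ∈ Z → f i ≡ f j → i ≡ j
    f-injective {i} {j} i∈ j∈ e with i ≟ j
    ... | yes i≡j = i≡j
    ... | no  i≢j with DG.distance connG (πᴳ i) (πᴳ j) | DH.distance connH (πᴴ i) (πᴴ j)
    ...   | a , Da | b , Db with ≤-total b a
    ...     | inj₁ b≤a = ≡-if-dominantᴳ Da Db b≤a (retractTo-injective
                (Equivalence.from (∂G⇔ _) (boundaryᴳ md i∈ j∈ i≢j Da Db b≤a))
                (Equivalence.from (∂G⇔ _) (boundaryᴳ md j∈ i∈ (i≢j ∘ sym) (DG.Dist-sym Da) (DH.Dist-sym Db) b≤a))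
                (combine-injectiveˡ {order G} {order H} _ _ _ _ e))
    ...     | inj₂ a≤b = ≡-if-dominantᴴ Da Db a≤b (retractTo-injective
                (Equivalence.from (∂H⇔ _) (boundaryᴴ md i∈ j∈ i≢j Da Db a≤b))
                (Equivalence.from (∂H⇔ _) (boundaryᴴ md j∈ i∈ (i≢j ∘ sym) (DG.Dist-sym Da) (DH.Dist-sym Db) a≤b))
                (combine-injectiveʳ {order G} {order H} _ _ _ _ e))

a+d<[a+b]+[c+d] : ∀ a b c d → 1 ≤ b → a + d < (a + b) + (c + d)
a+d<[a+b]+[c+d] a b c d 1≤b = begin-strict
  a + d           <⟨ +-monoʳ-< a (+-monoˡ-≤ d 1≤b) ⟩
  a + (b + d)     ≡⟨ +-assoc a b d ⟨
  (a + b) + d     ≤⟨ +-monoʳ-≤ (a + b) (m≤n+m d c) ⟩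
  (a + b) + (c + d) ∎
  where open ≤-Reasoning

module BlockGraphs (G : Graph) where

  open Walks G
  open Distance G

  private
    variable
      u v w x y w₁ w₂ : Vertex G
      k l : ℕ
      X : Subset (order G)

  ConnectedOn-hub : (P : Vertex G → Set) (hub : Vertex G) →
                    (∀ z → P z → ∃ λ k → Σ (Walk G z hub k) λ p → AllOn p P) → ConnectedOn G P
  ConnectedOn-hub P hub to-hub u v pu pv with to-hub u pu | to-hub v pv
  ... | k₁ , p₁ , a₁ | k₂ , p₂ , a₂ =
    k₁ + k₂ , p₁ ++ʷ reverseʷ p₂ , AllOn-++ p₁ (reverseʷ p₂) a₁ (AllOn-reverse p₂ a₂)

  LargerNonseparable : Subset (order G) → Set
  LargerNonseparable X = Σ (Subset (order G)) λ X′ → X ⊂ X′ × Nonseparable G X′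

  maximal-nonseparable : ¬ LargerNonseparable X →
                         ∀ X′ → X ⊆ X′ → Nonseparable G X′ → X′ ⊆ X
  maximal-nonseparable {X} ¬larger X′ X⊆X′ ns′ {y} y∈X′ with y ∈? X
  ... | yes y∈X = y∈X
  ... | no  y∉X = ⊥-elim (¬larger (X′ , (X⊆X′ , y , y∈X′ , y∉X) , ns′))

  nonseparable⇒¬¬block : (∃ λ x → x ∈ X) → Nonseparable G X →
                         ¬ ¬ (Σ (Subset (order G)) λ B → IsBlock G B × X ⊆ B)
  nonseparable⇒¬¬block {X} = extend X (⊃-wellFounded X)
    where
    extend : ∀ B → Acc _⊃_ B → (∃ λ x → x ∈ B) → Nonseparable G B →
             ¬ ¬ (Σ (Subset (order G)) λ B′ → IsBlock G B′ × B ⊆ B′)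
    extend B (acc larger) (x , x∈B) ns ¬block = ¬¬-excluded-middle {A = LargerNonseparable B} λ where
      (yes (B″ , B⊂B″ , ns″)) →
        extend B″ (larger B⊂B″) (x , proj₁ B⊂B″ x∈B) ns″
          (λ (B′ , blk , B″⊆B′) → ¬block (B′ , blk , λ z∈B → B″⊆B′ (proj₁ B⊂B″ z∈B)))
      (no ¬larger) → ¬block (B , ((x , x∈B) , ns , maximal-nonseparable ¬larger) , id)

  shorter-walk-avoids : (r : Walk G y w k) → w ≢ x → Dist G y x l → k ≤ l → AllOn r (_≢ x)
  shorter-walk-avoids {x = x} r w≢x (_ , x-min) k≤l with x ∈? verticesʷ r
  ... | no  x∉r = ∉vertices⇒AllOn≢ r x∉r
  ... | yes x∈r with split-at-vertex r (AllOn-⊤ r) x∈r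
  ...   | i , j , r₁ , r₂ , _ , _ , refl =
    ⊥-elim (<⇒≱ (<-≤-trans (m<m+n i (walk-length-pos r₂ (w≢x ∘ sym))) k≤l) (x-min i r₁))

  module CycleThrough (x~w₁ : Adj G x w₁) (x~w₂ : Adj G x w₂)
                      (r : Walk G w₁ w₂ m) (r-avoids : AllOn r (_≢ x))
                      (r-shortest : ∀ {j} (q : Walk G w₁ w₂ j) → AllOn q (_≢ x) → m ≤ j) where

    B : Subset (order G)
    B = ⁅ x ⁆ ∪ verticesʷ r

    x∈B : x ∈ B
    x∈B = x∈p∪q⁺ (inj₁ (x∈⁅x⁆ x))

    ∈B⁻ : y ∈ B → y ≡ x ⊎ y ∈ verticesʷ r
    ∈B⁻ y∈B with x∈p∪q⁻ ⁅ x ⁆ (verticesʷ r) y∈B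
    ... | inj₁ y∈x = inj₁ (x∈⁅y⁆⇒x≡y x y∈x)
    ... | inj₂ y∈r = inj₂ y∈r

    r⊆B : AllOn r (λ z → z ∈ B × z ≢ x)
    r⊆B = AllOn-zip r (AllOn-map (λ z∈r → x∈p∪q⁺ (inj₂ z∈r)) r (AllOn-vertices r)) r-avoids

    no-repeated-vertex : ∀ {z i j} (p₁ : Walk G w₁ z i) (p₂ : Walk G z w₂ j) →
      AllOn p₁ (_≢ x) → AllOn p₂ (_≢ x) → i + j ≡ m → y ≢ z → y ∈ verticesʷ p₁ → y ∈ verticesʷ p₂ → ⊥
    no-repeated-vertex p₁ p₂ a₁ a₂ refl y≢z y∈p₁ y∈p₂
      with split-at-vertex p₁ a₁ y∈p₁ | split-at-vertex p₂ a₂ y∈p₂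
    ... | i₁ , j₁ , s₁ , t₁ , as₁ , _ , refl | i₂ , j₂ , _ , s₂ , _ , as₂ , refl =
      <⇒≱ (a+d<[a+b]+[c+d] i₁ j₁ i₂ j₂ (walk-length-pos t₁ y≢z))
          (r-shortest (s₁ ++ʷ s₂) (AllOn-++ s₁ s₂ as₁ as₂))

    connected : ConnectedOn G (_∈ B)
    connected = ConnectedOn-hub _ x to-x
      where
      to-x : ∀ z → z ∈ B → ∃ λ k → Σ (Walk G z x k) λ p → AllOn p (_∈ B)
      to-x z z∈B with ∈B⁻ z∈B
      ... | inj₁ refl = 0 , nil , x∈B
      ... | inj₂ z∈r with split-at-vertex r r⊆B z∈r
      ...   | i , _ , p₁ , _ , p₁⊆B , _ , _ =
        suc i , reverseʷ p₁ ∷ʳʷ Adj-sym x~w₁ ,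
        AllOn-∷ʳ (reverseʷ p₁) _ (AllOn-reverse p₁ (AllOn-map proj₁ p₁ p₁⊆B)) x∈B

    -- After removing a vertex y ≢ x of r, one of the two parts of r joins any other vertex
    -- of r to x, since the shortest walk r passes through y only once.
    connected-without : ∀ y → y ∈ B → ConnectedOn G (λ z → z ∈ B × z ≢ y)
    connected-without y _ with y ≟ x
    ... | yes refl = ConnectedOn-hub _ w₁ to-w₁
      where
      to-w₁ : ∀ z → z ∈ B × z ≢ x → ∃ λ k → Σ (Walk G z w₁ k) λ p → AllOn p (λ t → t ∈ B × t ≢ x)
      to-w₁ z (z∈B , z≢x) with ∈B⁻ z∈B
      ... | inj₁ z≡x = ⊥-elim (z≢x z≡x)
      ... | inj₂ z∈r with split-at-vertex r r⊆B z∈r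
      ...   | i , _ , p₁ , _ , p₁⊆B , _ , _ = i , reverseʷ p₁ , AllOn-reverse p₁ p₁⊆B
    ... | no y≢x = ConnectedOn-hub _ x to-x
      where
      x∈B-y : x ∈ B × x ≢ y
      x∈B-y = x∈B , y≢x ∘ sym

      to-x : ∀ z → z ∈ B × z ≢ y → ∃ λ k → Σ (Walk G z x k) λ p → AllOn p (λ t → t ∈ B × t ≢ y)
      to-x z (z∈B , z≢y) with ∈B⁻ z∈B
      ... | inj₁ refl = 0 , nil , x∈B-y
      ... | inj₂ z∈r with split-at-vertex r r⊆B z∈r
      ...   | i , j , p₁ , p₂ , p₁⊆B , p₂⊆B , i+j≡m with y ∈? verticesʷ p₁ | y ∈? verticesʷ p₂
      ...     | no y∉p₁ | _ =
        suc i , reverseʷ p₁ ∷ʳʷ Adj-sym x~w₁ ,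
        AllOn-∷ʳ (reverseʷ p₁) _
          (AllOn-reverse p₁ (AllOn-zip p₁ (AllOn-map proj₁ p₁ p₁⊆B) (∉vertices⇒AllOn≢ p₁ y∉p₁))) x∈B-y
      ...     | yes _ | no y∉p₂ =
        suc j , p₂ ∷ʳʷ Adj-sym x~w₂ ,
        AllOn-∷ʳ p₂ _ (AllOn-zip p₂ (AllOn-map proj₁ p₂ p₂⊆B) (∉vertices⇒AllOn≢ p₂ y∉p₂)) x∈B-y
      ...     | yes y∈p₁ | yes y∈p₂ = ⊥-elim (no-repeated-vertex p₁ p₂
        (AllOn-map proj₂ p₁ p₁⊆B) (AllOn-map proj₂ p₂ p₂⊆B) i+j≡m (z≢y ∘ sym) y∈p₁ y∈p₂)

    nonseparable : Nonseparable G B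
    nonseparable = connected , connected-without

    ends-adjacent : IsBlockGraph G → w₁ ≢ w₂ → ¬ ¬ Adj G w₁ w₂
    ends-adjacent (_ , blocks-complete) w₁≢w₂ ¬w₁~w₂ =
      nonseparable⇒¬¬block (x , x∈B) nonseparable λ (B′ , B′-block , B⊆B′) →
        ¬w₁~w₂ (blocks-complete B′ B′-block w₁ w₂
          (B⊆B′ (proj₁ (AllOn-head r r⊆B))) (B⊆B′ (proj₁ (AllOn-last r r⊆B))) w₁≢w₂)

  separates-nonadjacent-neighbours : IsBlockGraph G → Adj G x w₁ → Adj G x w₂ →
                                     w₁ ≢ w₂ → ¬ Adj G w₁ w₂ → (r : Walk G w₁ w₂ m) → ¬ AllOn r (_≢ x)
  separates-nonadjacent-neighbours {x} {w₁} {w₂} bg x~w₁ x~w₂ w₁≢w₂ ¬w₁~w₂ r r-avoids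
    with least-witness (λ k → walkOn? (λ z → ¬? (z ≟ x)) k w₁ w₂) (r , r-avoids)
  ... | _ , (r′ , r′-avoids) , r′-shortest =
    CycleThrough.ends-adjacent x~w₁ x~w₂ r′ r′-avoids (λ q q-avoids → r′-shortest _ (q , q-avoids))
      bg w₁≢w₂ ¬w₁~w₂

  boundary-not-inner : IsBlockGraph G → InBoundary G x → (p : Walk G u v k) → Dist G u v k → ¬ Inner p x
  boundary-not-inner {x} bg (y , y≢x , _ , x-far) p (_ , p-min) x∈p
    with inner-split p x∈p | distance (proj₁ bg) y x
  ... | i , j , w₁ , w₂ , p₁ , w₁~x , x~w₂ , p₂ , refl | l , Dyx
    with distance (proj₁ bg) y w₁ | distance (proj₁ bg) y w₂
  ...   | k₁ , D₁@(r₁ , _) | k₂ , D₂@(r₂ , _) =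
    separates-nonadjacent-neighbours bg (Adj-sym w₁~x) x~w₂ w₁≢w₂ ¬w₁~w₂
      (reverseʷ r₁ ++ʷ r₂) (AllOn-++ (reverseʷ r₁) r₂ (AllOn-reverse r₁ avoids₁) avoids₂)
    where
    avoids₁ : AllOn r₁ (_≢ x)
    avoids₁ = shorter-walk-avoids r₁ (Adj-irrefl w₁~x) Dyx (x-far w₁ k₁ l (Adj-sym w₁~x) D₁ (Dist-sym Dyx))

    avoids₂ : AllOn r₂ (_≢ x)
    avoids₂ = shorter-walk-avoids r₂ (Adj-irrefl x~w₂ ∘ sym) Dyx (x-far w₂ k₂ l x~w₂ D₂ (Dist-sym Dyx))

    w₁≢w₂ : w₁ ≢ w₂
    w₁≢w₂ refl = <⇒≱ (+-mono-< (n<1+n i) (n<1+n j)) (p-min _ (p₁ ++ʷ p₂))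

    ¬w₁~w₂ : ¬ Adj G w₁ w₂
    ¬w₁~w₂ w₁~w₂ = <⇒≱ (+-monoˡ-< (suc j) (n<1+n i)) (p-min _ (p₁ ++ʷ cons w₁~w₂ p₂))

  boundary-outerGP : IsBlockGraph G → (S : Subset (order G)) → (∀ v → v ∈ S ⇔ InBoundary G v) → OuterGP G S
  boundary-outerGP bg S S⇔ = (λ u v _ _ _ → no-boundary-inner) , (λ u v _ _ → no-boundary-inner)
    where
    no-boundary-inner : Positionable G S u v
    no-boundary-inner _ p D x x∈p x∈S = boundary-not-inner bg (Equivalence.to (S⇔ x) x∈S) p D x∈p

theorem4p4 : (G H : Graph) → Connected G → Connected H →
    2 ≤ order G → 2 ≤ order H →
    (a b c bG bH : ℕ) →
    IsGpo G a → IsGpo H b → IsGpo (G ⊠ H) c →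
    BoundarySize G bG → BoundarySize H bH →
    (a * b ≤ c × c ≤ bG * bH) ×
    (IsBlockGraph G → IsBlockGraph H → a * b ≡ bG * bH)
theorem4p4 G H connG connH 2≤∣G∣ 2≤∣H∣ a b c bG bH
  ((X , X-outer , ∣X∣≡a) , X-max) ((Y , Y-outer , ∣Y∣≡b) , Y-max) ((Z , Z-outer , ∣Z∣≡c) , Z-max)
  (∂G , ∂G⇔ , ∣∂G∣≡bG) (∂H , ∂H⇔ , ∣∂H∣≡bH) =
  (ab≤c , c≤bGbH) , λ G-block H-block → ≤-antisym (≤-trans ab≤c c≤bGbH) (*-mono-≤
    (subst (_≤ a) ∣∂G∣≡bG (X-max ∂G (BlockGraphs.boundary-outerGP G G-block ∂G ∂G⇔)))
    (subst (_≤ b) ∣∂H∣≡bH (Y-max ∂H (BlockGraphs.boundary-outerGP H H-block ∂H ∂H⇔))))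
  where
  open ProductBounds G H connG connH

  ab≤c : a * b ≤ c
  ab≤c = subst (_≤ c) (trans (∣p×ˢq∣≡∣p∣*∣q∣ X Y) (cong₂ _*_ ∣X∣≡a ∣Y∣≡b))
           (Z-max (X ×ˢ Y) (×ˢ-outerGP X-outer Y-outer))

  c≤bGbH : c ≤ bG * bH
  c≤bGbH = subst₂ _≤_ ∣Z∣≡c (cong₂ _*_ ∣∂G∣≡bG ∣∂H∣≡bH)
    (outerGP-⊠-≤ Z-outer
      ∂G ∂G⇔ (Equivalence.from (∂G⇔ _) (proj₂ (Distance.boundary-nonempty G connG 2≤∣G∣)))
      ∂H ∂H⇔ (Equivalence.from (∂H⇔ _) (proj₂ (Distance.boundary-nonempty H connH 2≤∣H∣))))
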